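{- Let $n \geqslant 3$ and let $G$ be a strongly connected simple digraph of order $n$. Then $$\left| D(G) - D(\overline{G}) \right| \leqslant n-2 \qquad\text{and}\qquad \frac{D(G)}{D(\overline{G})} \leqslant n-1 .$$ Moreover, each of these two equalities holds if and only if $G \in \mathscr{B}_n$.
   Context: Digraphs are simple (no loops, no multiple arrows; both $(u,v)$ and $(v,u)$ may be present). A digraph is strongly connected if there is a directed path between any ordered pair of vertices. For a strongly connected digraph, $|x,y|_G$ is the length (number of arrows) of a shortest directed path from $x$ to $y$, and the diameter $D(G)$ is the maximum of $|x,y|_G$ over all ordered pairs. The symmetric version $\overline{G}$ of $G=(V,A)$ is $(V,A')$ where $(i,j)\in A'$ iff $(i,j)\in A$ or $(j,i)\in A$. The backward tournament $\mathcal{B}_n$ ($n\geqslant 3$) has vertices $v_1,\dots,v_n$ and arrows $(v_i,v_{i+1})$ for $1\leqslant i\leqslant n-1$ and $(v_i,v_j)$ for $3\leqslant i\leqslant n$, $1\leqslant j\leqslant i-2$. $\mathscr{B}_n$ denotes the set of digraphs obtained from $\mathcal{B}_n$ by adding any subset of the arrows $(v_i,v_{i-1})$, $2\leqslant i\leqslant n$. -}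

module Defs where

open import Data.Nat using (ℕ; zero; suc; _+_; _≤_)
open import Data.Bool using (Bool; true; false; _∨_)
open import Data.Fin using (Fin; toℕ)
open import Data.Fin.Permutation using (Permutation′; _⟨$⟩ʳ_)
open import Data.Product using (Σ; ∃; _×_)
open import Data.Sum using (_⊎_)
open import Relation.Nullary using (¬_)
open import Relation.Binary.PropositionalEquality using (_≡_)

-- A digraph on vertex set Fin n, given by its arrow relation (Bool-valued:
-- at most one arrow (i,j) for each ordered pair).
Digraph : ℕ → Set
Digraph n = Fin n → Fin n → Bool

-- simple: no loops (multiple arrows are impossible by construction)
Simple : ∀ {n} → Digraph n → Set
Simple G = ∀ i → G i i ≡ false

data Walk {n} (G : Digraph n) : Fin n → Fin n → ℕ → Set where
  here : ∀ {x} → Walk G x x zero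
  step : ∀ {x y z k} → G x y ≡ true → Walk G y z k → Walk G x z (suc k)

StronglyConnected : ∀ {n} → Digraph n → Set
StronglyConnected G = ∀ x y → ∃ λ k → Walk G x y k

-- d is the diameter: every ordered pair has distance ≤ d, and some ordered
-- pair has distance ≥ d (i.e. exactly d = max over pairs of shortest-path length)
IsDiameter : ∀ {n} → Digraph n → ℕ → Set
IsDiameter G d =
  (∀ x y → ∃ λ k → k ≤ d × Walk G x y k) ×
  (∃ λ x → ∃ λ y → ∀ k → Walk G x y k → d ≤ k)

Sym : ∀ {n} → Digraph n → Digraph n
Sym G i j = G i j ∨ G j i

-- Backward tournament B_n with v_{a} = index a-1 (0-based i = a-1):
-- forced arrows: (v_a, v_{a+1}) and (v_a, v_b) with b ≤ a-2
BForced : ∀ {n} → Fin n → Fin n → Set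
BForced i j = toℕ j ≡ suc (toℕ i) ⊎ 2 + toℕ j ≤ toℕ i

BOptional : ∀ {n} → Fin n → Fin n → Set
BOptional i j = suc (toℕ j) ≡ toℕ i

-- G ∈ 𝓑_n (up to relabelling of vertices by a permutation σ, v_a ↦ σ(a-1)):
-- all forced arrows present, no arrows other than forced/optional ones
InBn : ∀ {n} → Digraph n → Set
InBn {n} G = Σ (Permutation′ n) λ σ → ∀ i j →
  (BForced i j → G (σ ⟨$⟩ʳ i) (σ ⟨$⟩ʳ j) ≡ true) ×
  (¬ BForced i j → ¬ BOptional i j → G (σ ⟨$⟩ʳ i) (σ ⟨$⟩ʳ j) ≡ false)

-- A shortest walk between a diametral pair visits distinct vertices, so D(G) ≤ n − 1, while
-- 1 ≤ D(Ḡ) ≤ D(G) because walks of G are walks of Ḡ. Hence D(G) − D(Ḡ) ≤ n − 2 and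
-- D(G) ≤ (n − 1) D(Ḡ), each with equality exactly when D(G) = n − 1 and D(Ḡ) = 1. Then the
-- diametral geodesic v₁ → ⋯ → vₙ lists all vertices and has no forward chords, and as Ḡ is
-- complete every backward chord vᵢ → vⱼ with j ≤ i − 2 is an arrow: G ∈ 𝓑ₙ. Conversely, in a
-- member of 𝓑ₙ every arrow raises the index by at most one, so |v₁, vₙ| = n − 1, and any two
-- vertices are adjacent.
module Submission where

open import Defs
open import Data.Nat using (ℕ; _≤_; _∸_; _*_)
open import Data.Integer using (+_; _-_; ∣_∣)
open import Data.Product using (_×_)
open import Function.Bundles using (_⇔_)
open import Relation.Binary.PropositionalEquality using (_≡_)

open import Data.Nat using (zero; suc; _+_; _<_; z≤n; s≤s; s≤s⁻¹; _≤?_; >-nonZero)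
open import Data.Nat.Properties
  using (module ≤-Reasoning; _≟_; ≤-trans; ≤-antisym; ≤-reflexive; <⇒≤; <⇒≱; <-cmp; ≤∧≢⇒<;
         m≤n⇒m≤1+n; m≤n+m; n≤1+n;
         +-suc; +-identityʳ; +-monoˡ-≤; +-monoˡ-<; m+[n∸m]≡n; m∸n≤m; ∸-mono;
         m≤m*n; *-identityʳ; *-cancelˡ-≤; <⇒≤pred; 1+n≰n)
import Data.Integer.Properties as ℤ
open import Data.Fin using (Fin; toℕ; fromℕ; punchOut)
import Data.Fin as F
open import Data.Fin.Properties
  using (any?; toℕ-injective; toℕ<n; toℕ-fromℕ; injective⇒≤; punchOut-injective)
  renaming (_≟_ to _≟ᶠ_)
open import Data.Fin.Permutation using (Permutation′; _⟨$⟩ʳ_; permutation; _⟨$⟩ˡ_; inverseˡ; inverseʳ)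
open import Data.Bool using (true; false; _∨_)
open import Data.Bool.Properties using (∨-zeroʳ; ∨-identityʳ; ∨-comm)
open import Data.Product using (∃; ∃₂; _,_; proj₁; proj₂)
open import Data.Sum using (inj₁; inj₂)
open import Relation.Nullary using (¬_; yes; no)
open import Relation.Nullary.Negation using (contradiction)
open import Relation.Binary.PropositionalEquality using (module ≡-Reasoning; refl; sym; trans; cong; subst; subst₂; _≢_)
open import Relation.Binary.Definitions using (tri<; tri≈; tri>)
open import Function.Definitions using (Injective)
open import Function.Bundles using (mk⇔)
open import Function.Construct.Composition using (_⇔-∘_)
open import Function.Construct.Symmetry using (⇔-sym)

injective⇒surjective : ∀ {m} {f : Fin m → Fin m} → Injective _≡_ _≡_ f → ∀ y → ∃ λ x → f x ≡ y
injective⇒surjective {suc m} {f} inj y with any? (λ x → f x ≟ᶠ y)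
... | yes hit = hit
... | no miss = contradiction (injective⇒≤ {f = f′} f′-injective) 1+n≰n
  where
  f′ : Fin (suc m) → Fin m
  f′ x = punchOut {i = y} (λ eq → miss (x , sym eq))
  f′-injective : Injective _≡_ _≡_ f′
  f′-injective {a} {b} eq = inj (punchOut-injective (λ e → miss (a , sym e)) (λ e → miss (b , sym e)) eq)

injection⇒permutation : ∀ {m} (f : Fin m → Fin m) → Injective _≡_ _≡_ f → Permutation′ m
injection⇒permutation f inj = permutation f (λ y → proj₁ (surj y)) (λ y → proj₂ (surj y))
  (λ x → inj (proj₂ (surj (f x))))
  where surj = injective⇒surjective inj

+∸-< : ∀ {a b k} → a < b → b ≤ k → a + (k ∸ b) < k
+∸-< {a} {b} {k} a<b b≤k = subst (a + (k ∸ b) <_) (m+[n∸m]≡n b≤k) (+-monoˡ-< (k ∸ b) a<b)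

difference-extremal : ∀ {d e N} → 1 ≤ e → e ≤ d → d ≤ N → (d ∸ e ≡ N ∸ 1) ⇔ (d ≡ N × e ≡ 1)
difference-extremal 1≤e e≤d d≤N = mk⇔ (to 1≤e e≤d d≤N) λ { (refl , refl) → refl }
  where
  to : ∀ {d e N} → 1 ≤ e → e ≤ d → d ≤ N → d ∸ e ≡ N ∸ 1 → d ≡ N × e ≡ 1
  to {e = suc zero} _ (s≤s _) (s≤s _) eq = cong suc eq , refl
  to {e = suc (suc e)} _ (s≤s (s≤s {n = d} _)) (s≤s (s≤s d≤N)) eq =
    contradiction (≤-trans (≤-reflexive (sym eq)) (≤-trans (m∸n≤m d e) d≤N)) 1+n≰n

ratio-extremal : ∀ {d e N} → 1 ≤ e → d ≤ suc N → (d ≡ suc N * e) ⇔ (d ≡ suc N × e ≡ 1)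
ratio-extremal {d} {e} {N} 1≤e d≤N = mk⇔ to λ { (refl , refl) → sym (*-identityʳ (suc N)) }
  where
  to : d ≡ suc N * e → d ≡ suc N × e ≡ 1
  to refl = trans (cong (suc N *_) e≡1) (*-identityʳ (suc N)) , e≡1
    where
    e≡1 : e ≡ 1
    e≡1 = ≤-antisym (*-cancelˡ-≤ (suc N) (subst (suc N * e ≤_) (sym (*-identityʳ (suc N))) d≤N)) 1≤e

Shortest : ∀ {n} → Digraph n → Fin n → Fin n → ℕ → Set
Shortest G x y k = ∀ k′ → Walk G x y k′ → k ≤ k′

module _ {n : ℕ} {G : Digraph n} where

  infixr 5 _++ʷ_
  infixl 9 _at_

  _++ʷ_ : ∀ {x y z a b} → Walk G x y a → Walk G y z b → Walk G x z (a + b)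
  here ++ʷ w = w
  step e v ++ʷ w = step e (v ++ʷ w)

  -- the vertex reached after i arrows (the endpoint once i exceeds the length)
  _at_ : ∀ {x y k} → Walk G x y k → ℕ → Fin n
  _at_ {x} here _ = x
  _at_ {x} (step _ _) zero = x
  step _ w at suc i = w at i

  take : ∀ {x y k a} (w : Walk G x y k) → a ≤ k → Walk G x (w at a) a
  take {a = zero} here _ = here
  take {a = zero} (step _ _) _ = here
  take {a = suc a} (step e w) (s≤s a≤k) = step e (take w a≤k)

  drop : ∀ {x y k a} (w : Walk G x y k) → a ≤ k → Walk G (w at a) y (k ∸ a)
  drop {a = zero} here _ = here
  drop {a = zero} (step e w) _ = step e w
  drop {a = suc a} (step e w) (s≤s a≤k) = drop w a≤k

  arrow-at : ∀ {x y k a} (w : Walk G x y k) → a < k → G (w at a) (w at suc a) ≡ true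
  arrow-at {a = zero} (step e here) _ = e
  arrow-at {a = zero} (step e (step _ _)) _ = e
  arrow-at {a = suc a} (step e w) (s≤s a<k) = arrow-at w a<k

  module _ {x y k} (w : Walk G x y k) (shortest : Shortest G x y k) where

    shortest⇒at-injective : ∀ {a b} → a < b → b ≤ k → w at a ≢ w at b
    shortest⇒at-injective {a} {b} a<b b≤k eq = <⇒≱ (+∸-< a<b b≤k) (shortest _ shortcut)
      where
      shortcut : Walk G x y (a + (k ∸ b))
      shortcut = take w (≤-trans (<⇒≤ a<b) b≤k) ++ʷ subst (λ v → Walk G v y (k ∸ b)) (sym eq) (drop w b≤k)

    shortest⇒no-chord : ∀ {a b} → 2 + a ≤ b → b ≤ k → G (w at a) (w at b) ≡ false
    shortest⇒no-chord {a} {b} a+2≤b b≤k with G (w at a) (w at b) in chord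
    ... | false = refl
    ... | true = contradiction (shortest _ shortcut)
        (<⇒≱ (subst (_< k) (sym (+-suc a (k ∸ b))) (+∸-< a+2≤b b≤k)))
      where
      shortcut : Walk G x y (a + suc (k ∸ b))
      shortcut = take w (≤-trans (<⇒≤ (<⇒≤ a+2≤b)) b≤k) ++ʷ step chord (drop w b≤k)

    shortest⇒vertices-injective : Injective _≡_ _≡_ (λ (i : Fin (suc k)) → w at toℕ i)
    shortest⇒vertices-injective {i} {j} eq with <-cmp (toℕ i) (toℕ j)
    ... | tri< i<j _ _ = contradiction eq (shortest⇒at-injective i<j (s≤s⁻¹ (toℕ<n j)))
    ... | tri≈ _ i≡j _ = toℕ-injective i≡j
    ... | tri> _ _ j<i = contradiction (sym eq) (shortest⇒at-injective j<i (s≤s⁻¹ (toℕ<n i)))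

    shortest<n : k < n
    shortest<n = injective⇒≤ shortest⇒vertices-injective

  diametral-geodesic : ∀ {d} → IsDiameter G d → ∃₂ λ x y → Walk G x y d × Shortest G x y d
  diametral-geodesic (bounded , x , y , far) with bounded x y
  ... | k , k≤d , w = x , y , subst (Walk G x y) (≤-antisym k≤d (far k w)) w , far

  diameter<n : ∀ {d} → IsDiameter G d → d < n
  diameter<n hd with x , y , w , shortest ← diametral-geodesic hd = shortest<n w shortest

  Walk⇒Sym : ∀ {x y k} → Walk G x y k → Walk (Sym G) x y k
  Walk⇒Sym here = here
  Walk⇒Sym (step {y = y} e w) = step (cong (_∨ G y _) e) (Walk⇒Sym w)

  diameter-Sym≤diameter : ∀ {d d̄} → IsDiameter G d → IsDiameter (Sym G) d̄ → d̄ ≤ d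
  diameter-Sym≤diameter (bounded , _) (_ , x , y , far) with bounded x y
  ... | k , k≤d , w = ≤-trans (far k (Walk⇒Sym w)) k≤d

diameter-positive : ∀ {m d} {H : Digraph (suc (suc m))} → IsDiameter H d → 1 ≤ d
diameter-positive (bounded , _) with bounded F.zero (F.suc F.zero)
... | _ , k≤d , step _ _ = ≤-trans (s≤s z≤n) k≤d

diameter≡1⇒adjacent : ∀ {n} {H : Digraph n} → IsDiameter H 1 → ∀ {u v} → u ≢ v → H u v ≡ true
diameter≡1⇒adjacent (bounded , _) {u} {v} u≢v with bounded u v
... | _ , _ , here = contradiction refl u≢v
... | _ , _ , step e here = e
... | _ , s≤s () , step _ (step _ _)

adjacent⇒diameter≤1 : ∀ {n d} {H : Digraph n} → (∀ {u v} → u ≢ v → H u v ≡ true) →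
  IsDiameter H d → d ≤ 1
adjacent⇒diameter≤1 adjacent (_ , x , y , far) with x ≟ᶠ y
... | yes refl = ≤-trans (far 0 here) z≤n
... | no x≢y = far 1 (step (adjacent x≢y) here)

BackwardLabelling : ∀ {n} → Digraph n → Permutation′ n → Set
BackwardLabelling G σ = ∀ i j →
  (BForced i j → G (σ ⟨$⟩ʳ i) (σ ⟨$⟩ʳ j) ≡ true) ×
  (¬ BForced i j → ¬ BOptional i j → G (σ ⟨$⟩ʳ i) (σ ⟨$⟩ʳ j) ≡ false)

forced⇒≤suc : ∀ {n} {i j : Fin n} → BForced i j → toℕ j ≤ suc (toℕ i)
forced⇒≤suc (inj₁ j≡i+1) = ≤-reflexive j≡i+1
forced⇒≤suc {j = j} (inj₂ j+2≤i) = m≤n⇒m≤1+n (≤-trans (m≤n+m (toℕ j) 2) j+2≤i)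

optional⇒≤suc : ∀ {n} {i j : Fin n} → BOptional i j → toℕ j ≤ suc (toℕ i)
optional⇒≤suc j+1≡i = m≤n⇒m≤1+n (≤-trans (n≤1+n _) (≤-reflexive j+1≡i))

module Backward {n} {G : Digraph n} {σ : Permutation′ n} (labelling : BackwardLabelling G σ) where

  level : Fin n → ℕ
  level u = toℕ (σ ⟨$⟩ˡ u)

  level-injective : ∀ {u v} → level u ≡ level v → u ≡ v
  level-injective {u} {v} eq = begin
    u                       ≡⟨ inverseʳ σ ⟨
    σ ⟨$⟩ʳ (σ ⟨$⟩ˡ u)       ≡⟨ cong (σ ⟨$⟩ʳ_) (toℕ-injective eq) ⟩
    σ ⟨$⟩ʳ (σ ⟨$⟩ˡ v)       ≡⟨ inverseʳ σ ⟩
    v                       ∎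
    where open ≡-Reasoning

  forced : ∀ {u v} → BForced (σ ⟨$⟩ˡ u) (σ ⟨$⟩ˡ v) → G u v ≡ true
  forced f = subst₂ (λ a b → G a b ≡ true) (inverseʳ σ) (inverseʳ σ) (proj₁ (labelling _ _) f)

  absent : ∀ {u v} → ¬ BForced (σ ⟨$⟩ˡ u) (σ ⟨$⟩ˡ v) → ¬ BOptional (σ ⟨$⟩ˡ u) (σ ⟨$⟩ˡ v) →
    G u v ≡ false
  absent ¬f ¬o = subst₂ (λ a b → G a b ≡ false) (inverseʳ σ) (inverseʳ σ) (proj₂ (labelling _ _) ¬f ¬o)

  arrow-level : ∀ {u v} → G u v ≡ true → level v ≤ suc (level u)
  arrow-level {u} {v} e with level v ≤? suc (level u)
  ... | yes ok = ok
  ... | no jump with () ← trans (sym e) (absent (λ f → jump (forced⇒≤suc f)) (λ o → jump (optional⇒≤suc o)))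

  walk-level : ∀ {u v k} → Walk G u v k → level v ≤ level u + k
  walk-level here = ≤-reflexive (sym (+-identityʳ _))
  walk-level {u} {v} (step {y = y} {k = k} e w) = begin
    level v             ≤⟨ walk-level w ⟩
    level y + k         ≤⟨ +-monoˡ-≤ k (arrow-level e) ⟩
    suc (level u) + k   ≡⟨ +-suc (level u) k ⟨
    level u + suc k     ∎
    where open ≤-Reasoning

  Sym-adjacent-< : ∀ {u v} → level u < level v → Sym G u v ≡ true
  Sym-adjacent-< {u} {v} u<v with level v ≟ suc (level u)
  ... | yes next = cong (_∨ G v u) (forced (inj₁ next))
  ... | no ¬next =
    trans (cong (G u v ∨_) (forced (inj₂ (≤∧≢⇒< u<v (λ e → ¬next (sym e)))))) (∨-zeroʳ (G u v))

  Sym-adjacent : ∀ {u v} → u ≢ v → Sym G u v ≡ true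
  Sym-adjacent {u} {v} u≢v with <-cmp (level u) (level v)
  ... | tri< u<v _ _ = Sym-adjacent-< u<v
  ... | tri≈ _ eq _ = contradiction (level-injective eq) u≢v
  ... | tri> _ _ v<u = trans (∨-comm (G u v) (G v u)) (Sym-adjacent-< v<u)

backward⇒diameter≥ : ∀ {N d} {G : Digraph (suc N)} → InBn G → IsDiameter G d → N ≤ d
backward⇒diameter≥ {N} {G = G} (σ , labelling) (bounded , _) with bounded (σ ⟨$⟩ʳ F.zero) (σ ⟨$⟩ʳ fromℕ N)
... | k , k≤d , w = ≤-trans (subst₂ (λ a b → a ≤ b + k) level-last level-first (walk-level w)) k≤d
  where
  open Backward {G = G} {σ = σ} labelling
  level-last : level (σ ⟨$⟩ʳ fromℕ N) ≡ N
  level-last = trans (cong toℕ (inverseˡ σ)) (toℕ-fromℕ N)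
  level-first : level (σ ⟨$⟩ʳ F.zero) ≡ 0
  level-first = cong toℕ (inverseˡ σ)

backward⇒Sym-diameter≤1 : ∀ {n d̄} {G : Digraph n} → InBn G → IsDiameter (Sym G) d̄ → d̄ ≤ 1
backward⇒Sym-diameter≤1 {G = G} (σ , labelling) =
  adjacent⇒diameter≤1 (Backward.Sym-adjacent {G = G} {σ = σ} labelling)

extremal⇒backward : ∀ {N} {G : Digraph (suc N)} → Simple G → IsDiameter G N → IsDiameter (Sym G) 1 → InBn G
extremal⇒backward {N} {G} simple hd hs with x , y , w , shortest ← diametral-geodesic hd =
  σ , labelling
  where
  vertex : Fin (suc N) → Fin (suc N)
  vertex i = w at toℕ i

  toℕ≤N : ∀ (i : Fin (suc N)) → toℕ i ≤ N
  toℕ≤N i = s≤s⁻¹ (toℕ<n i)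

  σ : Permutation′ (suc N)
  σ = injection⇒permutation vertex (shortest⇒vertices-injective w shortest)

  labelling : BackwardLabelling G σ
  labelling i j = present , absent
    where
    present : BForced i j → G (vertex i) (vertex j) ≡ true
    present (inj₁ j≡i+1) = subst (λ t → G (vertex i) (w at t) ≡ true) (sym j≡i+1)
      (arrow-at w (subst (_≤ N) j≡i+1 (toℕ≤N j)))
    present (inj₂ j+2≤i) = trans (sym (∨-identityʳ _))
      (subst (λ c → G (vertex i) (vertex j) ∨ c ≡ true) (shortest⇒no-chord w shortest j+2≤i (toℕ≤N i))
        (diameter≡1⇒adjacent hs λ e →
          shortest⇒at-injective w shortest (≤-trans (n≤1+n _) j+2≤i) (toℕ≤N i) (sym e)))
    absent : ¬ BForced i j → ¬ BOptional i j → G (vertex i) (vertex j) ≡ false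
    absent ¬f ¬o with <-cmp (toℕ i) (toℕ j)
    ... | tri< i<j _ _ = shortest⇒no-chord w shortest (≤∧≢⇒< i<j (λ e → ¬f (inj₁ (sym e)))) (toℕ≤N j)
    ... | tri≈ _ i≡j _ = subst (λ t → G (vertex i) (vertex t) ≡ false) (toℕ-injective i≡j) (simple _)
    ... | tri> _ _ j<i = contradiction (inj₂ (≤∧≢⇒< j<i ¬o)) ¬f

backward⇔extremal : ∀ {m d d̄} {G : Digraph (suc (suc m))} → Simple G →
  IsDiameter G d → IsDiameter (Sym G) d̄ → InBn G ⇔ (d ≡ suc m × d̄ ≡ 1)
backward⇔extremal {G = G} simple hd hs = mk⇔
  (λ b → ≤-antisym (<⇒≤pred (diameter<n hd)) (backward⇒diameter≥ {G = G} b hd) ,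
         ≤-antisym (backward⇒Sym-diameter≤1 {G = G} b hs) (diameter-positive hs))
  (λ { (refl , refl) → extremal⇒backward simple hd hs })

theorem1 : (n : ℕ) → 3 ≤ n → (G : Digraph n) → Simple G → StronglyConnected G →
    (d d̄ : ℕ) → IsDiameter G d → IsDiameter (Sym G) d̄ →
      (∣ + d - + d̄ ∣ ≤ n ∸ 2) × (d ≤ (n ∸ 1) * d̄) ×
      ((∣ + d - + d̄ ∣ ≡ n ∸ 2) ⇔ InBn G) × ((d ≡ (n ∸ 1) * d̄) ⇔ InBn G)
theorem1 (suc (suc (suc m))) (s≤s (s≤s (s≤s _))) G simple _ d d̄ hd hs =
    subst (_≤ suc m) (sym gap) (∸-mono d≤N 1≤d̄)
  , ≤-trans d≤N (m≤m*n N d̄ {{>-nonZero 1≤d̄}})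
  , ⇔-sym extremal ⇔-∘
      subst (λ t → (t ≡ suc m) ⇔ (d ≡ N × d̄ ≡ 1)) (sym gap) (difference-extremal 1≤d̄ d̄≤d d≤N)
  , ⇔-sym extremal ⇔-∘ ratio-extremal 1≤d̄ d≤N
  where
  N : ℕ
  N = suc (suc m)
  d≤N : d ≤ N
  d≤N = <⇒≤pred (diameter<n hd)
  1≤d̄ : 1 ≤ d̄
  1≤d̄ = diameter-positive hs
  d̄≤d : d̄ ≤ d
  d̄≤d = diameter-Sym≤diameter hd hs
  gap : ∣ + d - + d̄ ∣ ≡ d ∸ d̄
  gap = cong ∣_∣ (trans (ℤ.m-n≡m⊖n d d̄) (ℤ.⊖-≥ d̄≤d))
  extremal : InBn G ⇔ (d ≡ N × d̄ ≡ 1)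
  extremal = backward⇔extremal simple hd hs
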